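{- Let $n\geq 1$, let $U_{6n}=\langle a,b\mid a^{2n}=b^3=1,\ a^{ -1}ba=b^{ -1}\rangle$, and let $\Gamma=\Gamma(U_{6n})$ be its non-commuting graph. Then the independence number of $\Gamma$ is $\alpha(\Gamma)=2n$.
   Context: The group $U_{6n}$ has order $6n$ and center $Z(U_{6n})=\langle a^2\rangle$. For a finite group $G$, the non-commuting graph $\Gamma(G)$ has vertex set $G\setminus Z(G)$, and two distinct vertices $x,y$ are adjacent iff $xy\neq yx$. $\alpha(\Gamma)$ is the maximum size of a set of pairwise non-adjacent vertices. -}

module Defs where

open import Data.Nat using (ℕ; suc; _+_; _*_; _≤_; NonZero)
open import Data.Nat.Properties using (m*n≢0)
open import Data.Nat.DivMod using (_mod_)
open import Data.Fin using (Fin; toℕ)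
open import Data.Nat using (_%_)
open import Data.Product using (_×_; _,_; Σ; ∃)
open import Data.List using (List; length)
open import Data.List.Membership.Propositional using (_∈_)
open import Data.List.Relation.Unary.All using (All)
open import Data.List.Relation.Unary.Unique.Propositional using (Unique)
open import Relation.Binary.PropositionalEquality using (_≡_)
open import Relation.Nullary using (¬_)

-- The element (i , j) stands for the normal form a^i b^j, with
-- i ∈ ℤ/2n and j ∈ ℤ/3.  From a^{-1} b a = b^{-1} we get
-- b^j a^k = a^k b^{(-1)^k j}, hence
-- (a^i b^j)(a^k b^l) = a^{i+k} b^{(-1)^k j + l}.
U : (n : ℕ) → Set
U n = Fin (2 * n) × Fin 3

-- (-1)^k j mod 3, with j < 3: equals j if k even, 2j if k odd.
twist : ℕ → ℕ → ℕ
twist k j = (1 + k % 2) * j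

mulU : (n : ℕ) .{{_ : NonZero n}} → U n → U n → U n
mulU n (i , j) (k , l) =
  ((toℕ i + toℕ k) mod (2 * n)) {{m*n≢0 2 n}} ,
  (twist (toℕ k) (toℕ j) + toℕ l) mod 3

module _ {G : Set} (_·_ : G → G → G) where

  Commute : G → G → Set
  Commute x y = x · y ≡ y · x

  Central : G → Set
  Central x = ∀ y → Commute x y

  -- An independent set of the non-commuting graph Γ(G) (vertex set G ∖ Z(G),
  -- x ~ y iff xy ≠ yx), given as a duplicate-free list of non-central
  -- elements that pairwise commute.
  IsIndependentSet : List G → Set
  IsIndependentSet S =
    Unique S × All (λ x → ¬ Central x) S ×
    (∀ {x y} → x ∈ S → y ∈ S → Commute x y)

  IndependenceNumber≡ : ℕ → Set
  IndependenceNumber≡ k =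
    (∃ λ S → IsIndependentSet S × length S ≡ k) ×
    (∀ S → IsIndependentSet S → length S ≤ k)

module Submission where

open import Defs
open import Data.Nat
  using (ℕ; zero; suc; _+_; _*_; _∸_; _≤_; _<_; _%_; _/_; NonZero; s≤s⁻¹; >-nonZero⁻¹)
open import Data.Nat.Properties
  using ( +-comm; +-identityʳ; *-comm; *-zeroʳ; m*n≢0; +-cancelʳ-≡; +-monoʳ-≤; *-monoʳ-≤
        ; ∸-monoˡ-≤; ≤-<-trans; ≮⇒≥; m≤n⇒m<n∨m≡n; n<1+n; module ≤-Reasoning)
open import Data.Nat.DivMod
  using (_mod_; m≡m%n+[m/n]*n; m*n%n≡0; m/n*n≤m; m%n<n; m<n⇒m%n≡m; %-remove-+ˡ)
open import Data.Nat.Divisibility using (m%n≡0⇒n∣m)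
open import Data.Fin using (Fin; zero; suc; toℕ; fromℕ<)
open import Data.Fin.Properties using (toℕ-injective; toℕ<n; toℕ-fromℕ<; pigeonhole; <⇒≢)
open import Data.Product using (_×_; _,_; proj₁; proj₂; ∃)
open import Data.Sum using (_⊎_; inj₁; inj₂)
open import Data.List using (List; _∷_; length; map; allFin; lookup)
open import Data.List.Properties using (length-map; length-tabulate)
open import Data.List.Membership.Propositional using (_∈_)
open import Data.List.Membership.Propositional.Properties using (∈-lookup; ∈-map⁻)
import Data.List.Relation.Unary.All as All
open import Data.List.Relation.Unary.AllPairs using (_∷_)
open import Data.List.Relation.Unary.Unique.Propositional using (Unique)
open import Data.List.Relation.Unary.Unique.Propositional.Properties using (map⁺; allFin⁺)
open import Relation.Binary.PropositionalEquality
open import Relation.Nullary using (¬_; contradiction)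

-- The elements a^i b^j with i even form an abelian subgroup ⟨a², b⟩ of
-- order 3n whose central part is ⟨a²⟩, so its 2n non-central elements are an
-- independent set. Conversely, an odd power a^i b^j commutes with an even one
-- a^k b^l only if l = 0, and with an odd one a^k b^l only if j = l. Hence an
-- independent set either consists of even non-central elements, or of odd
-- elements sharing the same b-exponent; in both cases it injects into ℤ/2n.

Unique⇒lookup-injective : ∀ {A : Set} {xs : List A} → Unique xs →
  ∀ {i j} → lookup xs i ≡ lookup xs j → i ≡ j
Unique⇒lookup-injective {xs = _ ∷ _} _ {zero} {zero} _ = refl
Unique⇒lookup-injective (x∉xs ∷ _)  {zero}  {suc j} eq =
  contradiction eq (All.lookup x∉xs (∈-lookup j))
Unique⇒lookup-injective (x∉xs ∷ _)  {suc i} {zero}  eq =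
  contradiction (sym eq) (All.lookup x∉xs (∈-lookup i))
Unique⇒lookup-injective (_ ∷ u)     {suc i} {suc j} eq =
  cong suc (Unique⇒lookup-injective u eq)

length≤-of-injectiveOn : ∀ {A : Set} {m} {xs : List A} → Unique xs →
  (f : A → Fin m) → (∀ {x y} → x ∈ xs → y ∈ xs → f x ≡ f y → x ≡ y) →
  length xs ≤ m
length≤-of-injectiveOn {xs = xs} u f inj = ≮⇒≥ λ m<len →
  let i , j , i<j , fi≡fj = pigeonhole m<len (λ i → f (lookup xs i))
  in <⇒≢ i<j (Unique⇒lookup-injective u (inj (∈-lookup i) (∈-lookup j) fi≡fj))

%2≡0⊎%2≡1 : ∀ m → m % 2 ≡ 0 ⊎ m % 2 ≡ 1
%2≡0⊎%2≡1 zero          = inj₁ refl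
%2≡0⊎%2≡1 (suc zero)    = inj₂ refl
%2≡0⊎%2≡1 (suc (suc m)) = %2≡0⊎%2≡1 m

[m+d]%2≡d : ∀ {m d} → m % 2 ≡ 0 → d < 2 → (m + d) % 2 ≡ d
[m+d]%2≡d {m} {d} m-even d<2 =
  trans (%-remove-+ˡ d (m%n≡0⇒n∣m m 2 m-even)) (m<n⇒m%n≡m d<2)

even+bit-injective : ∀ {m m′ d d′} → m % 2 ≡ 0 → m′ % 2 ≡ 0 → d < 2 → d′ < 2 →
  m + d ≡ m′ + d′ → m ≡ m′ × d ≡ d′
even+bit-injective {m} {m′} {d} {d′} m-even m′-even d<2 d′<2 eq =
  +-cancelʳ-≡ d m m′ (trans eq (cong (m′ +_) (sym d≡d′))) , d≡d′
  where
  d≡d′ : d ≡ d′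
  d≡d′ = begin
    d            ≡⟨ sym ([m+d]%2≡d {m} m-even d<2) ⟩
    (m + d) % 2   ≡⟨ cong (_% 2) eq ⟩
    (m′ + d′) % 2 ≡⟨ [m+d]%2≡d {m′} m′-even d′<2 ⟩
    d′            ∎
    where open ≡-Reasoning

even<even⇒suc< : ∀ {m n} → m % 2 ≡ 0 → n % 2 ≡ 0 → m < n → suc m < n
even<even⇒suc< {m} m-even n-even m<n with m≤n⇒m<n∨m≡n m<n
... | inj₁ suc-m<n = suc-m<n
... | inj₂ refl    = contradiction
  (trans (sym ([m+d]%2≡d {m} m-even (n<1+n 1))) (trans (cong (_% 2) (+-comm m 1)) n-even))
  λ ()

twist-even : ∀ m j → m % 2 ≡ 0 → twist m j ≡ j
twist-even _ j m-even rewrite m-even = +-identityʳ j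

twist-odd : ∀ m j → m % 2 ≡ 1 → twist m j ≡ 2 * j
twist-odd _ j m-odd rewrite m-odd = refl

2j+l≡2l+j⇒j≡l : ∀ (j l : Fin 3) →
  (2 * toℕ j + toℕ l) mod 3 ≡ (2 * toℕ l + toℕ j) mod 3 → j ≡ l
2j+l≡2l+j⇒j≡l zero             zero             _ = refl
2j+l≡2l+j⇒j≡l zero             (suc zero)       ()
2j+l≡2l+j⇒j≡l zero             (suc (suc zero)) ()
2j+l≡2l+j⇒j≡l (suc zero)       zero             ()
2j+l≡2l+j⇒j≡l (suc zero)       (suc zero)       _ = refl
2j+l≡2l+j⇒j≡l (suc zero)       (suc (suc zero)) ()
2j+l≡2l+j⇒j≡l (suc (suc zero)) zero             ()
2j+l≡2l+j⇒j≡l (suc (suc zero)) (suc zero)       ()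
2j+l≡2l+j⇒j≡l (suc (suc zero)) (suc (suc zero)) _ = refl

2j+l≡l+j⇒j≡0 : ∀ (j l : Fin 3) →
  (2 * toℕ j + toℕ l) mod 3 ≡ (toℕ l + toℕ j) mod 3 → j ≡ zero
2j+l≡l+j⇒j≡0 zero             _                _ = refl
2j+l≡l+j⇒j≡0 (suc zero)       zero             ()
2j+l≡l+j⇒j≡0 (suc zero)       (suc zero)       ()
2j+l≡l+j⇒j≡0 (suc zero)       (suc (suc zero)) ()
2j+l≡l+j⇒j≡0 (suc (suc zero)) zero             ()
2j+l≡l+j⇒j≡0 (suc (suc zero)) (suc zero)       ()
2j+l≡l+j⇒j≡0 (suc (suc zero)) (suc (suc zero)) ()

keyℕ : ℕ → ℕ → ℕ
keyℕ i j = i + (1 ∸ i % 2) * (j ∸ 1)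

keyℕ-even : ∀ i j → i % 2 ≡ 0 → keyℕ i j ≡ i + (j ∸ 1)
keyℕ-even i j i-even rewrite i-even = cong (i +_) (+-identityʳ (j ∸ 1))

keyℕ-odd : ∀ i j → i % 2 ≡ 1 → keyℕ i j ≡ i
keyℕ-odd i j i-odd rewrite i-odd = +-identityʳ i

module _ (n : ℕ) .{{_ : NonZero n}} where

  private
    _·_ : U n → U n → U n
    _·_ = mulU n

  Even Odd : Fin (2 * n) → Set
  Even i = toℕ i % 2 ≡ 0
  Odd  i = toℕ i % 2 ≡ 1

  2n-even : (2 * n) % 2 ≡ 0
  2n-even = trans (cong (_% 2) (*-comm 2 n)) (m*n%n≡0 n 2)

  commute-of-twist : ∀ i j k l →
    (twist (toℕ k) (toℕ j) + toℕ l) mod 3 ≡ (twist (toℕ i) (toℕ l) + toℕ j) mod 3 →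
    Commute _·_ (i , j) (k , l)
  commute-of-twist i _ k _ =
    cong₂ _,_ (cong (λ m → (m mod (2 * n)) {{m*n≢0 2 n}}) (+-comm (toℕ i) (toℕ k)))

  even-commute : ∀ i j k l → Even i → Even k → Commute _·_ (i , j) (k , l)
  even-commute i j k l i-even k-even = commute-of-twist i j k l (cong (_mod 3) (begin
    twist (toℕ k) (toℕ j) + toℕ l
      ≡⟨ cong (_+ toℕ l) (twist-even (toℕ k) (toℕ j) k-even) ⟩
    toℕ j + toℕ l
      ≡⟨ +-comm (toℕ j) (toℕ l) ⟩
    toℕ l + toℕ j
      ≡⟨ cong (_+ toℕ j) (sym (twist-even (toℕ i) (toℕ l) i-even)) ⟩
    twist (toℕ i) (toℕ l) + toℕ j ∎))
    where open ≡-Reasoning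

  even-central : ∀ i j → Even i → j ≡ zero → Central _·_ (i , j)
  even-central i _ i-even refl (k , l) = commute-of-twist i zero k l (cong (_mod 3) (begin
    twist (toℕ k) 0 + toℕ l   ≡⟨ cong (_+ toℕ l) (*-zeroʳ (1 + toℕ k % 2)) ⟩
    toℕ l                     ≡⟨ sym (+-identityʳ (toℕ l)) ⟩
    toℕ l + 0                 ≡⟨ cong (_+ 0) (sym (twist-even (toℕ i) (toℕ l) i-even)) ⟩
    twist (toℕ i) (toℕ l) + 0 ∎))
    where open ≡-Reasoning

  odd-commute⇒≡ : ∀ i j k l → Odd i → Odd k → Commute _·_ (i , j) (k , l) → j ≡ l
  odd-commute⇒≡ i j k l i-odd k-odd comm = 2j+l≡2l+j⇒j≡l j l (begin
    (2 * toℕ j + toℕ l) mod 3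
      ≡⟨ cong (λ t → (t + toℕ l) mod 3) (sym (twist-odd (toℕ k) (toℕ j) k-odd)) ⟩
    (twist (toℕ k) (toℕ j) + toℕ l) mod 3
      ≡⟨ cong proj₂ comm ⟩
    (twist (toℕ i) (toℕ l) + toℕ j) mod 3
      ≡⟨ cong (λ t → (t + toℕ j) mod 3) (twist-odd (toℕ i) (toℕ l) i-odd) ⟩
    (2 * toℕ l + toℕ j) mod 3 ∎)
    where open ≡-Reasoning

  even-odd-commute⇒≡0 : ∀ i j k l → Even i → Odd k → Commute _·_ (i , j) (k , l) → j ≡ zero
  even-odd-commute⇒≡0 i j k l i-even k-odd comm = 2j+l≡l+j⇒j≡0 j l (begin
    (2 * toℕ j + toℕ l) mod 3
      ≡⟨ cong (λ t → (t + toℕ l) mod 3) (sym (twist-odd (toℕ k) (toℕ j) k-odd)) ⟩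
    (twist (toℕ k) (toℕ j) + toℕ l) mod 3
      ≡⟨ cong proj₂ comm ⟩
    (twist (toℕ i) (toℕ l) + toℕ j) mod 3
      ≡⟨ cong (λ t → (t + toℕ j) mod 3) (twist-even (toℕ i) (toℕ l) i-even) ⟩
    (toℕ l + toℕ j) mod 3 ∎)
    where open ≡-Reasoning

  1<2n : 1 < 2 * n
  1<2n = *-monoʳ-≤ 2 (>-nonZero⁻¹ n)

  a : U n
  a = fromℕ< 1<2n , zero

  a-odd : Odd (proj₁ a)
  a-odd = cong (_% 2) (toℕ-fromℕ< 1<2n)

  even-nonCentral : ∀ i j → Even i → j ≢ zero → ¬ Central _·_ (i , j)
  even-nonCentral i j i-even j≢0 central =
    j≢0 (even-odd-commute⇒≡0 i j (proj₁ a) (proj₂ a) i-even a-odd (central a))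

  even-nonCentral⇒≢0 : ∀ i j → Even i → ¬ Central _·_ (i , j) → j ≢ zero
  even-nonCentral⇒≢0 i j i-even ¬central j≡0 = ¬central (even-central i j i-even j≡0)

  keyℕ<2n : ∀ i (j : Fin 3) → keyℕ (toℕ i) (toℕ j) < 2 * n
  keyℕ<2n i j with %2≡0⊎%2≡1 (toℕ i)
  ... | inj₁ i-even = begin-strict
    keyℕ (toℕ i) (toℕ j) ≡⟨ keyℕ-even (toℕ i) (toℕ j) i-even ⟩
    toℕ i + (toℕ j ∸ 1)  ≤⟨ +-monoʳ-≤ (toℕ i) (∸-monoˡ-≤ 1 (s≤s⁻¹ (toℕ<n j))) ⟩
    toℕ i + 1            ≡⟨ +-comm (toℕ i) 1 ⟩
    suc (toℕ i)          <⟨ even<even⇒suc< i-even 2n-even (toℕ<n i) ⟩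
    2 * n                ∎
    where open ≤-Reasoning
  ... | inj₂ i-odd = subst (_< 2 * n) (sym (keyℕ-odd (toℕ i) (toℕ j) i-odd)) (toℕ<n i)

  key : U n → Fin (2 * n)
  key (i , j) = fromℕ< (keyℕ<2n i j)

  toℕ-key : ∀ i j → toℕ (key (i , j)) ≡ keyℕ (toℕ i) (toℕ j)
  toℕ-key i j = toℕ-fromℕ< (keyℕ<2n i j)

  [t/2]*2<2n : ∀ (t : Fin (2 * n)) → toℕ t / 2 * 2 < 2 * n
  [t/2]*2<2n t = ≤-<-trans (m/n*n≤m (toℕ t) 2) (toℕ<n t)

  embed : Fin (2 * n) → U n
  embed t = fromℕ< ([t/2]*2<2n t) , suc (toℕ t mod 2)

  embed-even : ∀ t → Even (proj₁ (embed t))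
  embed-even t = trans (cong (_% 2) (toℕ-fromℕ< ([t/2]*2<2n t))) (m*n%n≡0 (toℕ t / 2) 2)

  key-embed : ∀ t → key (embed t) ≡ t
  key-embed t = toℕ-injective (begin
    toℕ (key (embed t))
      ≡⟨ toℕ-key i (suc r) ⟩
    keyℕ (toℕ i) (suc (toℕ r))
      ≡⟨ keyℕ-even (toℕ i) (suc (toℕ r)) (embed-even t) ⟩
    toℕ i + toℕ r
      ≡⟨ cong₂ _+_ (toℕ-fromℕ< ([t/2]*2<2n t)) (toℕ-fromℕ< (m%n<n (toℕ t) 2)) ⟩
    toℕ t / 2 * 2 + toℕ t % 2
      ≡⟨ +-comm (toℕ t / 2 * 2) (toℕ t % 2) ⟩
    toℕ t % 2 + toℕ t / 2 * 2
      ≡⟨ sym (m≡m%n+[m/n]*n (toℕ t) 2) ⟩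
    toℕ t ∎)
    where
    open ≡-Reasoning
    i = proj₁ (embed t)
    r = toℕ t mod 2

  embed-injective : ∀ {t t′} → embed t ≡ embed t′ → t ≡ t′
  embed-injective {t} {t′} eq = trans (sym (key-embed t)) (trans (cong key eq) (key-embed t′))

  evenNonCentrals : List (U n)
  evenNonCentrals = map embed (allFin (2 * n))

  length-evenNonCentrals : length evenNonCentrals ≡ 2 * n
  length-evenNonCentrals =
    trans (length-map embed (allFin (2 * n))) (length-tabulate {n = 2 * n} (λ t → t))

  evenNonCentrals-independent : IsIndependentSet _·_ evenNonCentrals
  evenNonCentrals-independent =
    map⁺ embed-injective (allFin⁺ (2 * n)) ,
    All.tabulate (λ x∈ → nonCentral (∈-map⁻ embed x∈)) ,
    λ x∈ y∈ → commute (∈-map⁻ embed x∈) (∈-map⁻ embed y∈)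
    where
    nonCentral : ∀ {x} → ∃ (λ t → t ∈ allFin (2 * n) × x ≡ embed t) → ¬ Central _·_ x
    nonCentral (t , _ , refl) =
      even-nonCentral (proj₁ (embed t)) (proj₂ (embed t)) (embed-even t) λ ()
    commute : ∀ {x y} → ∃ (λ t → t ∈ allFin (2 * n) × x ≡ embed t) →
      ∃ (λ t → t ∈ allFin (2 * n) × y ≡ embed t) → Commute _·_ x y
    commute (t , _ , refl) (t′ , _ , refl) =
      even-commute (proj₁ (embed t)) (proj₂ (embed t)) (proj₁ (embed t′)) (proj₂ (embed t′))
        (embed-even t) (embed-even t′)

  even-key-injective : ∀ i j k l → Even i → Even k → j ≢ zero → l ≢ zero →
    key (i , j) ≡ key (k , l) → (i , j) ≡ (k , l)
  even-key-injective _ zero    _ _       _ _ j≢0 _ _ = contradiction refl j≢0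
  even-key-injective _ (suc _) _ zero    _ _ _ l≢0 _ = contradiction refl l≢0
  even-key-injective i (suc j) k (suc l) i-even k-even _ _ eq =
    let i≡k , j≡l = even+bit-injective i-even k-even (toℕ<n j) (toℕ<n l) (begin
          toℕ i + toℕ j                ≡⟨ sym (keyℕ-even (toℕ i) (suc (toℕ j)) i-even) ⟩
          keyℕ (toℕ i) (suc (toℕ j))   ≡⟨ sym (toℕ-key i (suc j)) ⟩
          toℕ (key (i , suc j))        ≡⟨ cong toℕ eq ⟩
          toℕ (key (k , suc l))        ≡⟨ toℕ-key k (suc l) ⟩
          keyℕ (toℕ k) (suc (toℕ l))   ≡⟨ keyℕ-even (toℕ k) (suc (toℕ l)) k-even ⟩
          toℕ k + toℕ l                ∎)
    in cong₂ _,_ (toℕ-injective i≡k) (cong suc (toℕ-injective j≡l))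
    where open ≡-Reasoning

  odd-key-injective : ∀ i j k l → Odd i → Odd k → key (i , j) ≡ key (k , l) → i ≡ k
  odd-key-injective i j k l i-odd k-odd eq = toℕ-injective (begin
    toℕ i                 ≡⟨ sym (keyℕ-odd (toℕ i) (toℕ j) i-odd) ⟩
    keyℕ (toℕ i) (toℕ j)  ≡⟨ sym (toℕ-key i j) ⟩
    toℕ (key (i , j))     ≡⟨ cong toℕ eq ⟩
    toℕ (key (k , l))     ≡⟨ toℕ-key k l ⟩
    keyℕ (toℕ k) (toℕ l)  ≡⟨ keyℕ-odd (toℕ k) (toℕ l) k-odd ⟩
    toℕ k                 ∎)
    where open ≡-Reasoning

  key-injectiveOn : ∀ {T} → IsIndependentSet _·_ T →
    ∀ {x y} → x ∈ T → y ∈ T → key x ≡ key y → x ≡ y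
  key-injectiveOn (_ , nonCentral , commute) {i , j} {k , l} x∈ y∈ eq
    with %2≡0⊎%2≡1 (toℕ i) | %2≡0⊎%2≡1 (toℕ k)
  ... | inj₁ i-even | inj₁ k-even = even-key-injective i j k l i-even k-even
    (even-nonCentral⇒≢0 i j i-even (All.lookup nonCentral x∈))
    (even-nonCentral⇒≢0 k l k-even (All.lookup nonCentral y∈)) eq
  ... | inj₁ i-even | inj₂ k-odd = contradiction
    (even-odd-commute⇒≡0 i j k l i-even k-odd (commute x∈ y∈))
    (even-nonCentral⇒≢0 i j i-even (All.lookup nonCentral x∈))
  ... | inj₂ i-odd | inj₁ k-even = contradiction
    (even-odd-commute⇒≡0 k l i j k-even i-odd (commute y∈ x∈))
    (even-nonCentral⇒≢0 k l k-even (All.lookup nonCentral y∈))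
  ... | inj₂ i-odd | inj₂ k-odd = cong₂ _,_
    (odd-key-injective i j k l i-odd k-odd eq)
    (odd-commute⇒≡ i j k l i-odd k-odd (commute x∈ y∈))

  independent⇒length≤2n : ∀ {T} → IsIndependentSet _·_ T → length T ≤ 2 * n
  independent⇒length≤2n ind@(unique , _) =
    length≤-of-injectiveOn unique key (key-injectiveOn ind)

theorem2p7 : (n : ℕ) .{{_ : NonZero n}} →
    IndependenceNumber≡ (mulU n) (2 * n)
theorem2p7 n =
  (evenNonCentrals n , evenNonCentrals-independent n , length-evenNonCentrals n) ,
  λ _ → independent⇒length≤2n n
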